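{- Let $w$ be a word (with at least two distinct letters) of length $\ell$, and define $c_{\mathrm{left}}$ = the maximum length of a palindromic prefix of $w$; $c_{\mathrm{right}}$ = the maximum length of a palindromic suffix of $w$; $c_{\mathrm{repeat}}$ = the maximum length of a string that is both a proper prefix and a proper suffix of $w$ (possibly $0$). Then: (a) If $w$ is not a palindrome, \[C_1(w)=\max\left(\frac1{\ell-c_{\mathrm{repeat}}},\ \frac1{\ell-\frac{c_{\mathrm{left}}+c_{\mathrm{right}}}2}\right).\] (b) If $w$ is a palindrome, then $c_{\mathrm{left}}=c_{\mathrm{right}}=\ell$ and $C_1(w)=\frac2{\ell-c_{\mathrm{repeat}}}$.
   Context: A word is a finite string $w=w_0\cdots w_{\ell-1}$ of letters; a prefix (suffix) is a string of consecutive letters starting (ending) $w$, and proper means not equal to $w$. A one-dimensional grid of size $n$ is a map $\Gamma\colon\mathbb Z/n\mathbb Z\to\Sigma$ to an alphabet. An appearance of $w$ in $\Gamma$ is a pair $(p,v)\in\mathbb Z/n\mathbb Z\times\{ -1,1\}$ with $\Gamma(p+iv)=w_i$ for $0\le i<\ell$. The concentration $c_1(w,\Gamma)$ is the number of appearances divided by $n$, and $C_1(w)$ is the supremum of $c_1(w,\Gamma)$ over all one-dimensional grids (all $n$, all alphabets). -}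

module Defs where

open import Data.Nat using (ℕ; zero; suc; _+_; _*_; _∸_; _⊔_)
open import Data.Nat.DivMod using (_mod_)
open import Data.Fin using (Fin; toℕ)
open import Data.List using (List; []; _∷_; length; map; upTo; allFin; take; drop; reverse; foldr)
open import Data.Nat.ListAction using (sum)
open import Data.List.Properties using (≡-dec)
open import Data.Nat.Properties using (_≟_)
open import Data.Bool using (if_then_else_)
open import Data.Integer using (+_)
open import Data.Rational using (ℚ; _/_; 0ℚ; _≤_; _<_)
open import Data.Product using (Σ; _×_; ∃-syntax)
open import Relation.Nullary.Decidable using (⌊_⌋)
open import Relation.Binary.PropositionalEquality using (_≡_)

-- Words over the alphabet ℕ (any finite alphabet embeds in ℕ).
Word : Set
Word = List ℕ

_≟w_ : (u v : Word) → _
_≟w_ = ≡-dec _≟_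

-- A one-dimensional grid of size n = suc m : ℤ/nℤ → ℕ, with ℤ/nℤ = Fin (suc m).
Grid : ℕ → Set
Grid m = Fin (suc m) → ℕ

-- Direction v ∈ {-1, 1}.
data Dir : Set where
  fwd bwd : Dir

-- the position p + i v in ℤ/(suc m)ℤ  (note -i ≡ m * i mod (suc m))
pos : (m : ℕ) → Fin (suc m) → Dir → ℕ → Fin (suc m)
pos m p fwd i = (toℕ p + i) mod (suc m)
pos m p bwd i = (toℕ p + m * i) mod (suc m)

readAt : (m : ℕ) → Grid m → Fin (suc m) → Dir → ℕ → Word
readAt m Γ p v ℓ = map (λ i → Γ (pos m p v i)) (upTo ℓ)

isAppearance : Word → (m : ℕ) → Grid m → Fin (suc m) → Dir → Set
isAppearance w m Γ p v = readAt m Γ p v (length w) ≡ w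

appearances : Word → (m : ℕ) → Grid m → ℕ
appearances w m Γ =
  sum (map (λ p → sum (map (λ v → if ⌊ readAt m Γ p v (length w) ≟w w ⌋ then 1 else 0)
                               (fwd ∷ bwd ∷ [])))
           (allFin (suc m)))

c₁ : Word → (m : ℕ) → Grid m → ℚ
c₁ w m Γ = (+ appearances w m Γ) / suc m

C₁-is : Word → ℚ → Set
C₁-is w q =
  (∀ (m : ℕ) (Γ : Grid m) → c₁ w m Γ ≤ q) ×
  (∀ (r : ℚ) → r < q → ∃[ m ] Σ (Grid m) (λ Γ → r < c₁ w m Γ))

Palindrome : Word → Set
Palindrome u = reverse u ≡ u

isPal : Word → ℕ → ℕ
isPal u k = if ⌊ reverse u ≟w u ⌋ then k else 0

maxList : List ℕ → ℕ
maxList = foldr _⊔_ 0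

cLeft : Word → ℕ
cLeft w = maxList (map (λ k → isPal (take k w) k) (upTo (suc (length w))))

cRight : Word → ℕ
cRight w = maxList (map (λ k → isPal (drop (length w ∸ k) w) k) (upTo (suc (length w))))

cRepeat : Word → ℕ
cRepeat w = maxList (map (λ k → if ⌊ take k w ≟w drop (length w ∸ k) w ⌋ then k else 0)
                         (upTo (length w)))

-- a / b as a rational (b = 0 ↦ 0; only used with b > 0)
frac : ℕ → ℕ → ℚ
frac a zero = 0ℚ
frac a (suc b) = (+ a) / suc b

{-# OPTIONS --safe #-}

-- The upper bound is a packing argument. Double the circle ℤ/n of a grid to ℤ/2n and give
-- every appearance an arc of length K: a forward appearance at x the arc starting at 2x + s_F,
-- a backward one whose reversed word starts at x the arc starting at 2x + s_B. Two appearances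
-- in the same direction overlap in a border of w, so they lie at least ℓ − c_repeat apart; a
-- backward appearance starts at least ℓ − c_right after a forward one and a forward one at
-- least ℓ − c_left after a backward one, as their overlaps are palindromic suffixes and
-- prefixes. For K = min(2(ℓ − c_repeat), (ℓ − c_left) + (ℓ − c_right)), s_F = 2(ℓ − c_right)
-- and s_B = K (for a palindrome K = ℓ − c_repeat, s_F = 0, s_B = K) the arcs are disjoint, so
-- there are at most 2n / K appearances.
-- The bounds are attained: w has period ℓ − c_repeat, so the grid of that size reading w
-- periodically contains w, and also its reversal if w is a palindrome; reflecting w in its
-- longest palindromic prefix and suffix gives a grid of size (ℓ − c_left) + (ℓ − c_right)
-- containing w in both directions.

module Submission where

open import Defs
open import Data.Nat
  using (ℕ; zero; suc; _+_; _*_; _∸_; _≤_; _<_; _⊓_; s≤s; z≤n; z<s; s≤s⁻¹; NonZero; _<?_; _≤?_; >-nonZero; >-nonZero⁻¹)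
open import Data.Nat.Properties
open import Data.Nat.DivMod using (_%_; _/_; _mod_; m%n<n; m≡m%n+[m/n]*n; [m+kn]%n≡m%n; m<n⇒m%n≡m; [m+n]%n≡m%n)
open import Data.Nat.ListAction using () renaming (sum to sumᴸ)
open import Data.Nat.Tactic.RingSolver using (solve-∀)
open import Data.Fin using (Fin; toℕ; zero; suc)
import Data.Fin.Properties as Fin
open import Data.Fin.Properties
  using (toℕ-inject₁; toℕ-fromℕ; toℕ-injective; toℕ<n; toℕ-fromℕ<; fromℕ<-cong; fromℕ<-toℕ)
import Data.Integer as ℤ
import Data.Integer.Properties as ℤ
open import Data.Rational as ℚ using (ℚ; _⊔_)
import Data.Rational.Properties as ℚ
open import Data.Rational.Unnormalised using (mkℚᵘ; *≤*)
import Data.Rational.Unnormalised.Properties as ℚᵘ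
open import Data.List using ([]; _∷_; length; map; upTo; applyUpTo; tabulate; allFin; take; drop; reverse; _++_; [_])
open import Data.List.Properties
  using (length-take; length-drop; length-reverse; unfold-reverse; map-tabulate; map-upTo; length-applyUpTo)
open import Data.List.Membership.Propositional using (_∈_)
open import Data.List.Membership.Propositional.Properties using (foldr-selective; ∈-map⁻; ∈-map⁺; ∈-upTo⁺; ∈-upTo⁻)
open import Data.List.Relation.Unary.Any using (here; there)
open import Data.Bool using (if_then_else_)
open import Data.Empty using (⊥)
open import Data.Product using (Σ; _×_; _,_; proj₁; proj₂; ∃-syntax)
open import Data.Sum using (_⊎_; inj₁; inj₂; [_,_]′)
open import Function using (_∘_; id; _⇔_; mk⇔; Equivalence)
open import Function.Properties.Equivalence using () renaming (trans to ⇔-trans)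
open import Level using (0ℓ)
open import Relation.Nullary using (¬_; Dec; yes; no; contradiction)
open import Relation.Nullary.Decidable using (⌊_⌋)
open import Relation.Unary using (Decidable)
open import Relation.Binary.Bundles using (Setoid)
open import Relation.Binary.Definitions using (tri<; tri≈; tri>)
open import Relation.Binary.PropositionalEquality hiding ([_])
import Relation.Binary.Reasoning.Setoid
open import Algebra.Properties.Semiring.Sum +-*-semiring
  using (sum-syntax; sum-cong-≗; ∑-comm; ∑-distrib-+; *-distribˡ-sum; *-distribʳ-sum; sum-init-last; sum-replicate-zero)


n∸suc[m]<n : ∀ {m n} → m < n → n ∸ suc m < n
n∸suc[m]<n {m} {suc n} _ = s≤s (m∸n≤m n m)

[o∸n]+[n∸suc[m]]≡o∸suc[m] : ∀ {m n o} → m < n → n ≤ o → o ∸ n + (n ∸ suc m) ≡ o ∸ suc m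
[o∸n]+[n∸suc[m]]≡o∸suc[m] {m} {n} {o} m<n n≤o = trans (sym (+-∸-assoc (o ∸ n) m<n)) (cong (_∸ suc m) (m∸n+n≡m n≤o))

m+suc[n∸suc[m]]≡n : ∀ {m n} → m < n → m + suc (n ∸ suc m) ≡ n
m+suc[n∸suc[m]]≡n {m} m<n = trans (+-suc m _) (m+[n∸m]≡n m<n)

n∸1≡[n∸suc[m]]+m : ∀ {m n} → m < n → n ∸ 1 ≡ n ∸ suc m + m
n∸1≡[n∸suc[m]]+m {m} m<n = trans (cong (_∸ 1) (sym (m+[n∸m]≡n m<n))) (+-comm m _)

m+suc[n]≡n+suc[m] : ∀ m n → m + suc n ≡ n + suc m
m+suc[n]≡n+suc[m] m n = trans (+-suc m n) (trans (cong suc (+-comm m n)) (sym (+-suc n m)))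

m+suc[n]≡o⇒o∸suc[n]≡m : ∀ {m n o} → m + suc n ≡ o → o ∸ suc n ≡ m
m+suc[n]≡o⇒o∸suc[n]≡m {m} {n} refl = m+n∸n≡m m (suc n)

m<o∸n⇒n+m<o : ∀ {m n o} → n ≤ o → m < o ∸ n → n + m < o
m<o∸n⇒n+m<o {n = n} n≤o m<o∸n = subst (_ <_) (m+[n∸m]≡n n≤o) (+-monoʳ-< n m<o∸n)

[n<m⇒m∸n≤o]⇒m∸o≤n : ∀ m {n o} → (n < m → m ∸ n ≤ o) → m ∸ o ≤ n
[n<m⇒m∸n≤o]⇒m∸o≤n m {n} {o} bound with n <? m
... | no  n≮m = ≤-trans (m∸n≤m m o) (≮⇒≥ n≮m)
... | yes n<m = m≤n+o⇒m∸n≤o m o (begin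
  m             ≤⟨ m≤n+m∸n m n ⟩
  n + (m ∸ n)   ≤⟨ +-monoʳ-≤ n (bound n<m) ⟩
  n + o         ≡⟨ +-comm n o ⟩
  o + n         ∎)
  where open ≤-Reasoning

2*m∸[n+o]≡[m∸n]+[m∸o] : ∀ {m n o} → n ≤ m → o ≤ m → 2 * m ∸ (n + o) ≡ (m ∸ n) + (m ∸ o)
2*m∸[n+o]≡[m∸n]+[m∸o] {m} {n} {o} n≤m o≤m = begin
  2 * m ∸ (n + o)                           ≡⟨ cong (_∸ (n + o)) (cong₂ (λ x y → x + (y + 0)) (m∸n+n≡m n≤m) (m∸n+n≡m o≤m)) ⟨
  (m ∸ n + n) + ((m ∸ o + o) + 0) ∸ (n + o) ≡⟨ cong (_∸ (n + o)) (regroup (m ∸ n) (m ∸ o) n o) ⟩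
  (m ∸ n) + (m ∸ o) + (n + o) ∸ (n + o)     ≡⟨ m+n∸n≡m _ (n + o) ⟩
  (m ∸ n) + (m ∸ o)                         ∎
  where
  open ≡-Reasoning
  regroup : ∀ a b n o → (a + n) + ((b + o) + 0) ≡ (a + b) + (n + o)
  regroup = solve-∀

0<m*n⇒0<m×0<n : ∀ {m n} → 0 < m * n → 0 < m × 0 < n
0<m*n⇒0<m×0<n {suc m} {zero}  pos = contradiction (*-zeroʳ (suc m)) (>⇒≢ pos)
0<m*n⇒0<m×0<n {suc m} {suc n} _   = z<s , z<s

0<m+n⇒0<m⊎0<n : ∀ {m n} → 0 < m + n → 0 < m ⊎ 0 < n
0<m+n⇒0<m⊎0<n {suc m} _   = inj₁ z<s
0<m+n⇒0<m⊎0<n {zero}  pos = inj₂ pos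

m+n≤1 : ∀ {m n} → m ≤ 1 → n ≤ 1 → (0 < m → 0 < n → ⊥) → m + n ≤ 1
m+n≤1 {zero}          _   n≤1 _    = n≤1
m+n≤1 {suc m} {zero}  m≤1 _   _    = subst (_≤ 1) (sym (+-identityʳ _)) m≤1
m+n≤1 {suc m} {suc n} _   _   both = contradiction (both z<s z<s) λ ()

-- Indices past the end of a word read as 0; the lemmas below only look inside the word.
infixl 9 _!_
_!_ : Word → ℕ → ℕ
[]      ! i     = 0
(x ∷ u) ! zero  = x
(x ∷ u) ! suc i = u ! i

!-ext : ∀ {u v : Word} → length u ≡ length v → (∀ {i} → i < length u → u ! i ≡ v ! i) → u ≡ v
!-ext {[]}    {[]}    _   _  = refl
!-ext {x ∷ u} {y ∷ v} len eq = cong₂ _∷_ (eq z<s) (!-ext (suc-injective len) (eq ∘ s≤s))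

!-take : ∀ k (u : Word) {i} → i < k → take k u ! i ≡ u ! i
!-take (suc k) []      _         = refl
!-take (suc k) (x ∷ u) {zero}  _ = refl
!-take (suc k) (x ∷ u) {suc i} i<k = !-take k u (s≤s⁻¹ i<k)

!-drop : ∀ k (u : Word) i → drop k u ! i ≡ u ! (k + i)
!-drop zero    u       i = refl
!-drop (suc k) []      i = refl
!-drop (suc k) (x ∷ u) i = !-drop k u i

!-++ˡ : ∀ (u v : Word) {i} → i < length u → (u ++ v) ! i ≡ u ! i
!-++ˡ (x ∷ u) v {zero}  _   = refl
!-++ˡ (x ∷ u) v {suc i} i<u = !-++ˡ u v (s≤s⁻¹ i<u)

!-++ʳ : ∀ (u v : Word) i → (u ++ v) ! (length u + i) ≡ v ! i
!-++ʳ []      v i = refl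
!-++ʳ (x ∷ u) v i = !-++ʳ u v i

!-reverse : ∀ (u : Word) {i} → i < length u → reverse u ! i ≡ u ! (length u ∸ suc i)
!-reverse (x ∷ u) {i} i≤u rewrite unfold-reverse x u with m≤n⇒m<n∨m≡n (s≤s⁻¹ i≤u)
... | inj₁ i<u = begin
  (reverse u ++ [ x ]) ! i       ≡⟨ !-++ˡ (reverse u) [ x ] (subst (i <_) (sym (length-reverse u)) i<u) ⟩
  reverse u ! i                  ≡⟨ !-reverse u i<u ⟩
  u ! (length u ∸ suc i)         ≡⟨ cong ((x ∷ u) !_) (+-∸-assoc 1 i<u) ⟨
  (x ∷ u) ! (length u ∸ i)       ∎
  where open ≡-Reasoning
... | inj₂ refl = begin
  (reverse u ++ [ x ]) ! length u         ≡⟨ cong ((reverse u ++ [ x ]) !_) (+-identityʳ _) ⟨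
  (reverse u ++ [ x ]) ! (length u + 0)   ≡⟨ cong (λ k → (reverse u ++ [ x ]) ! (k + 0)) (length-reverse u) ⟨
  (reverse u ++ [ x ]) ! (length (reverse u) + 0) ≡⟨ !-++ʳ (reverse u) [ x ] 0 ⟩
  x                                       ≡⟨ cong ((x ∷ u) !_) (n∸n≡0 (length u)) ⟨
  (x ∷ u) ! (length u ∸ length u)         ∎
  where open ≡-Reasoning

!-applyUpTo : ∀ (f : ℕ → ℕ) {n i} → i < n → applyUpTo f n ! i ≡ f i
!-applyUpTo f {suc n} {zero}  _   = refl
!-applyUpTo f {suc n} {suc i} i<n = !-applyUpTo (f ∘ suc) (s≤s⁻¹ i<n)

length-take-≤ : ∀ {k} (w : Word) → k ≤ length w → length (take k w) ≡ k
length-take-≤ {k} w k≤w = trans (length-take k w) (m≤n⇒m⊓n≡m k≤w)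

length-drop-∸ : ∀ {k} (w : Word) → k ≤ length w → length (drop (length w ∸ k) w) ≡ k
length-drop-∸ {k} w k≤w = trans (length-drop (length w ∸ k) w) (m∸[m∸n]≡n k≤w)

PalindromicPrefix PalindromicSuffix Border : Word → ℕ → Set
PalindromicPrefix w k = ∀ {i} → i < k → w ! i ≡ w ! (k ∸ suc i)
PalindromicSuffix w k = ∀ {i} → i < k → w ! (length w ∸ k + i) ≡ w ! (length w ∸ suc i)
Border            w k = ∀ {i} → i < k → w ! i ≡ w ! (length w ∸ k + i)

palindrome⇔palindromicPrefix : ∀ u → Palindrome u ⇔ PalindromicPrefix u (length u)
palindrome⇔palindromicPrefix u = mk⇔
  (λ pal {i} i<u → trans (cong (_! i) (sym pal)) (!-reverse u i<u))
  (λ sym-u → !-ext (length-reverse u) λ i<u →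
     let i<u′ = subst (_ <_) (length-reverse u) i<u in trans (!-reverse u i<u′) (sym (sym-u i<u′)))

palindromicPrefix-take : ∀ k (w : Word) → PalindromicPrefix (take k w) k ⇔ PalindromicPrefix w k
palindromicPrefix-take k w = mk⇔
  (λ pp {i} i<k → trans (sym (!-take k w i<k)) (trans (pp i<k) (!-take k w (n∸suc[m]<n i<k))))
  (λ pp {i} i<k → trans (!-take k w i<k) (trans (pp i<k) (sym (!-take k w (n∸suc[m]<n i<k)))))

palindromicPrefix⇔ : ∀ w {k} → k ≤ length w → Palindrome (take k w) ⇔ PalindromicPrefix w k
palindromicPrefix⇔ w {k} k≤w = ⇔-trans
  (subst (λ n → Palindrome (take k w) ⇔ PalindromicPrefix (take k w) n) (length-take-≤ w k≤w)
         (palindrome⇔palindromicPrefix (take k w)))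
  (palindromicPrefix-take k w)

palindromicSuffix-drop : ∀ {k} (w : Word) → k ≤ length w →
                         PalindromicPrefix (drop (length w ∸ k) w) k ⇔ PalindromicSuffix w k
palindromicSuffix-drop {k} w k≤w = mk⇔
  (λ pp {i} i<k → trans (sym (!-drop d w i)) (trans (pp i<k) (reflected i<k)))
  (λ ps {i} i<k → trans (!-drop d w i) (trans (ps i<k) (sym (reflected i<k))))
  where
  d = length w ∸ k
  reflected : ∀ {i} → i < k → drop d w ! (k ∸ suc i) ≡ w ! (length w ∸ suc i)
  reflected {i} i<k = trans (!-drop d w (k ∸ suc i)) (cong (w !_) ([o∸n]+[n∸suc[m]]≡o∸suc[m] i<k k≤w))

palindromicSuffix⇔ : ∀ w {k} → k ≤ length w → Palindrome (drop (length w ∸ k) w) ⇔ PalindromicSuffix w k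
palindromicSuffix⇔ w {k} k≤w = ⇔-trans
  (subst (λ n → Palindrome (drop (length w ∸ k) w) ⇔ PalindromicPrefix (drop (length w ∸ k) w) n)
         (length-drop-∸ w k≤w) (palindrome⇔palindromicPrefix (drop (length w ∸ k) w)))
  (palindromicSuffix-drop w k≤w)

border⇔ : ∀ w {k} → k ≤ length w → (take k w ≡ drop (length w ∸ k) w) ⇔ Border w k
border⇔ w {k} k≤w = mk⇔
  (λ eq {i} i<k → trans (sym (!-take k w i<k)) (trans (cong (_! i) eq) (!-drop (length w ∸ k) w i)))
  (λ b → !-ext (trans (length-take-≤ w k≤w) (sym (length-drop-∸ w k≤w))) λ {i} i<n →
     let i<k = subst (i <_) (length-take-≤ w k≤w) i<n in
     trans (!-take k w i<k) (trans (b i<k) (sym (!-drop (length w ∸ k) w i))))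

∈⇒≤maxList : ∀ {x xs} → x ∈ xs → x ≤ maxList xs
∈⇒≤maxList (here refl)  = m≤m⊔n _ _
∈⇒≤maxList (there x∈xs) = ≤-trans (∈⇒≤maxList x∈xs) (m≤n⊔m _ _)

maxList-sel : ∀ xs → maxList xs ≡ 0 ⊎ maxList xs ∈ xs
maxList-sel = foldr-selective ⊔-sel 0

module _ {Q : ℕ → Set} (Q? : Decidable Q) where

  private
    candidate : ℕ → ℕ
    candidate k = if ⌊ Q? k ⌋ then k else 0

  largest : ℕ → ℕ
  largest n = maxList (map candidate (upTo n))

  largest-greatest : ∀ {n k} → k < n → Q k → k ≤ largest n
  largest-greatest {n} {k} k<n qk = subst (_≤ largest n) candidate≡ (∈⇒≤maxList (∈-map⁺ candidate (∈-upTo⁺ k<n)))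
    where
    candidate≡ : candidate k ≡ k
    candidate≡ with Q? k
    ... | yes _ = refl
    ... | no ¬qk = contradiction qk ¬qk

  largest-spec : ∀ n → largest n ≡ 0 ⊎ (Q (largest n) × largest n < n)
  largest-spec n with maxList-sel (map candidate (upTo n))
  ... | inj₁ ≡0 = inj₁ ≡0
  ... | inj₂ ∈cs with ∈-map⁻ candidate ∈cs
  ...   | k , k∈ , eq with Q? k
  ...     | yes qk = inj₂ (subst Q (sym eq) qk , subst (_< n) (sym eq) (∈-upTo⁻ k∈))
  ...     | no  _  = inj₁ eq

cLeft-spec : ∀ w → PalindromicPrefix w (cLeft w) × cLeft w ≤ length w
cLeft-spec w with largest-spec (λ k → reverse (take k w) ≟w take k w) (suc (length w))
... | inj₁ ≡0 = subst (λ c → PalindromicPrefix w c × c ≤ length w) (sym ≡0) ((λ ()) , z≤n)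
... | inj₂ (pal , <1+w) = Equivalence.to (palindromicPrefix⇔ w (s≤s⁻¹ <1+w)) pal , s≤s⁻¹ <1+w

cLeft-greatest : ∀ w {k} → k ≤ length w → PalindromicPrefix w k → k ≤ cLeft w
cLeft-greatest w k≤w pp =
  largest-greatest (λ k → reverse (take k w) ≟w take k w) (s≤s k≤w) (Equivalence.from (palindromicPrefix⇔ w k≤w) pp)

cRight-spec : ∀ w → PalindromicSuffix w (cRight w) × cRight w ≤ length w
cRight-spec w with largest-spec (λ k → reverse (drop (length w ∸ k) w) ≟w drop (length w ∸ k) w) (suc (length w))
... | inj₁ ≡0 = subst (λ c → PalindromicSuffix w c × c ≤ length w) (sym ≡0) ((λ ()) , z≤n)
... | inj₂ (pal , <1+w) = Equivalence.to (palindromicSuffix⇔ w (s≤s⁻¹ <1+w)) pal , s≤s⁻¹ <1+w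

cRight-greatest : ∀ w {k} → k ≤ length w → PalindromicSuffix w k → k ≤ cRight w
cRight-greatest w k≤w ps = largest-greatest (λ k → reverse (drop (length w ∸ k) w) ≟w drop (length w ∸ k) w)
  (s≤s k≤w) (Equivalence.from (palindromicSuffix⇔ w k≤w) ps)

cRepeat-spec : ∀ w → 0 < length w → Border w (cRepeat w) × cRepeat w < length w
cRepeat-spec w 0<w with largest-spec (λ k → take k w ≟w drop (length w ∸ k) w) (length w)
... | inj₁ ≡0 = subst (λ c → Border w c × c < length w) (sym ≡0) ((λ ()) , 0<w)
... | inj₂ (eq , <w) = Equivalence.to (border⇔ w (<⇒≤ <w)) eq , <w

cRepeat-greatest : ∀ w {k} → k < length w → Border w k → k ≤ cRepeat w
cRepeat-greatest w k<w b =
  largest-greatest (λ k → take k w ≟w drop (length w ∸ k) w) k<w (Equivalence.from (border⇔ w (<⇒≤ k<w)) b)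

cLeft-palindrome : ∀ w → Palindrome w → cLeft w ≡ length w
cLeft-palindrome w pal = ≤-antisym (proj₂ (cLeft-spec w))
  (cLeft-greatest w ≤-refl (Equivalence.to (palindrome⇔palindromicPrefix w) pal))

cRight-palindrome : ∀ w → Palindrome w → cRight w ≡ length w
cRight-palindrome w pal = ≤-antisym (proj₂ (cRight-spec w)) (cRight-greatest w ≤-refl λ {i} i<w →
  trans (cong (λ j → w ! (j + i)) (n∸n≡0 (length w))) (Equivalence.to (palindrome⇔palindromicPrefix w) pal i<w))

cLeft<length : ∀ w → ¬ Palindrome w → cLeft w < length w
cLeft<length w ¬pal = ≤∧≢⇒< (proj₂ (cLeft-spec w)) λ L≡w →
  ¬pal (Equivalence.from (palindrome⇔palindromicPrefix w) (subst (PalindromicPrefix w) L≡w (proj₁ (cLeft-spec w))))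

cLeft-positive : ∀ w → 0 < length w → 0 < cLeft w
cLeft-positive w 0<ℓ = cLeft-greatest w 0<ℓ λ { {zero} _ → refl ; {suc _} (s≤s ()) }

infix 4 _≡_modulo_
_≡_modulo_ : ℕ → ℕ → ℕ → Set
a ≡ b modulo n = ∃[ k ] ∃[ k′ ] a + k * n ≡ b + k′ * n

module _ {n : ℕ} where

  mod-refl : ∀ {a} → a ≡ a modulo n
  mod-refl = 0 , 0 , refl

  ≡⇒mod : ∀ {a b} → a ≡ b → a ≡ b modulo n
  ≡⇒mod refl = mod-refl

  mod-sym : ∀ {a b} → a ≡ b modulo n → b ≡ a modulo n
  mod-sym (k , k′ , eq) = k′ , k , sym eq

  mod-trans : ∀ {a b c} → a ≡ b modulo n → b ≡ c modulo n → a ≡ c modulo n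
  mod-trans {a} {b} {c} (k₁ , k₂ , ab) (k₃ , k₄ , bc) = k₁ + k₃ , k₄ + k₂ , (begin
    a + (k₁ + k₃) * n   ≡⟨ shuffle a k₁ k₃ n ⟩
    a + k₁ * n + k₃ * n ≡⟨ cong (_+ k₃ * n) ab ⟩
    b + k₂ * n + k₃ * n ≡⟨ swap b k₂ k₃ n ⟩
    b + k₃ * n + k₂ * n ≡⟨ cong (_+ k₂ * n) bc ⟩
    c + k₄ * n + k₂ * n ≡⟨ shuffle c k₄ k₂ n ⟨
    c + (k₄ + k₂) * n   ∎)
    where
    open ≡-Reasoning
    shuffle : ∀ x i j n → x + (i + j) * n ≡ x + i * n + j * n
    shuffle = solve-∀
    swap : ∀ x i j n → x + i * n + j * n ≡ x + j * n + i * n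
    swap = solve-∀

  mod-+ʳ : ∀ {a b} c → a ≡ b modulo n → a + c ≡ b + c modulo n
  mod-+ʳ {a} {b} c (k , k′ , eq) = k , k′ , trans (move a c k n) (trans (cong (_+ c) eq) (sym (move b c k′ n)))
    where
    move : ∀ x c i n → x + c + i * n ≡ x + i * n + c
    move = solve-∀

  mod-+ˡ : ∀ {a b} c → a ≡ b modulo n → c + a ≡ c + b modulo n
  mod-+ˡ {a} {b} c ab = subst₂ (_≡_modulo n) (+-comm a c) (+-comm b c) (mod-+ʳ c ab)

  mod-cancelʳ : ∀ {a b} c → a + c ≡ b + c modulo n → a ≡ b modulo n
  mod-cancelʳ {a} {b} c (k , k′ , eq) = k , k′ , +-cancelʳ-≡ c _ _ (trans (sym (move a c k n)) (trans eq (move b c k′ n)))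
    where
    move : ∀ x c i n → x + c + i * n ≡ x + i * n + c
    move = solve-∀

  mod-cancelˡ : ∀ {a b} c → c + a ≡ c + b modulo n → a ≡ b modulo n
  mod-cancelˡ {a} {b} c cab = mod-cancelʳ c (subst₂ (_≡_modulo n) (+-comm c a) (+-comm c b) cab)

  mod-*ˡ : ∀ {a b} c → a ≡ b modulo n → c * a ≡ c * b modulo c * n
  mod-*ˡ {a} {b} c (k , k′ , eq) = k , k′ , trans (distrib c a k n) (trans (cong (c *_) eq) (sym (distrib c b k′ n)))
    where
    distrib : ∀ c x i n → c * x + i * (c * n) ≡ c * (x + i * n)
    distrib = solve-∀

  +*-mod : ∀ a k → a + k * n ≡ a modulo n
  +*-mod a k = 0 , k , +-identityʳ _

  +-mod : ∀ a → a + n ≡ a modulo n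
  +-mod a = subst (λ x → x ≡ a modulo n) (cong (a +_) (+-identityʳ n)) (+*-mod a 1)

  %-mod : .{{_ : NonZero n}} → ∀ a → a % n ≡ a modulo n
  %-mod a = a / n , 0 , trans (sym (m≡m%n+[m/n]*n a n)) (sym (+-identityʳ a))

  mod⇒%≡ : .{{_ : NonZero n}} → ∀ {a b} → a ≡ b modulo n → a % n ≡ b % n
  mod⇒%≡ {a} {b} (k , k′ , eq) = trans (sym ([m+kn]%n≡m%n a k n)) (trans (cong (_% n) eq) ([m+kn]%n≡m%n b k′ n))

  mod-<⇒≡ : .{{_ : NonZero n}} → ∀ {a b} → a < n → b < n → a ≡ b modulo n → a ≡ b
  mod-<⇒≡ {a} {b} a<n b<n ab = trans (sym (m<n⇒m%n≡m a<n)) (trans (mod⇒%≡ ab) (m<n⇒m%n≡m b<n))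

  mod-within-period : ∀ {a b} → a ≡ b modulo n → b < a → a < b + n → ⊥
  mod-within-period {a} {b} (k , k′ , eq) b<a a<b+n with k′ ≤? k
  ... | yes k′≤k = <-irrefl (sym eq) (+-mono-<-≤ b<a (*-monoˡ-≤ n k′≤k))
  ... | no  k′≰k = <-irrefl eq (begin-strict
    a + k * n      <⟨ +-monoˡ-< (k * n) a<b+n ⟩
    b + n + k * n  ≡⟨ +-assoc b n (k * n) ⟩
    b + suc k * n  ≤⟨ +-monoʳ-≤ b (*-monoˡ-≤ n (≰⇒> k′≰k)) ⟩
    b + k′ * n     ∎)
    where open ≤-Reasoning

-- m * i represents −i modulo m + 1.
+-+pred*-mod : ∀ m y i → y + i + m * i ≡ y modulo suc m
+-+pred*-mod m y i = subst (_≡ y modulo suc m) (sym (collect y i m)) (+*-mod y i)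
  where
  collect : ∀ y i m → y + i + m * i ≡ y + i * suc m
  collect = solve-∀

mod-setoid : ℕ → Setoid 0ℓ 0ℓ
mod-setoid n = record
  { Carrier       = ℕ
  ; _≈_           = _≡_modulo n
  ; isEquivalence = record { refl = mod-refl ; sym = mod-sym ; trans = mod-trans }
  }

module mod-Reasoning (n : ℕ) = Relation.Binary.Reasoning.Setoid (mod-setoid n)

-- gap n x y is the residue of y − x modulo n.
gap : (n : ℕ) → .{{_ : NonZero n}} → ℕ → ℕ → ℕ
gap n x y = (y + (n ∸ 1) * x) % n

gap<n : ∀ n .{{_ : NonZero n}} x y → gap n x y < n
gap<n n x y = m%n<n _ n

+-gap : ∀ n .{{_ : NonZero n}} x y → x + gap n x y ≡ y modulo n
+-gap n x y = mod-trans (mod-+ˡ x (%-mod _)) (subst (_≡ y modulo n) (sym unfold) (+*-mod y x))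
  where
  shift : ∀ x y c → x + (y + c * x) ≡ y + x * (c + 1)
  shift = solve-∀
  unfold : x + (y + (n ∸ 1) * x) ≡ y + x * n
  unfold = trans (shift x y (n ∸ 1)) (cong (λ c → y + x * c) (m∸n+n≡m (>-nonZero⁻¹ n)))

𝟙[_] : ∀ {P : Set} → Dec P → ℕ
𝟙[ d ] = if ⌊ d ⌋ then 1 else 0

module _ {P : Set} where

  𝟙≤1 : (d : Dec P) → 𝟙[ d ] ≤ 1
  𝟙≤1 (yes _) = ≤-refl
  𝟙≤1 (no  _) = z≤n

  𝟙-yes : (d : Dec P) → P → 𝟙[ d ] ≡ 1
  𝟙-yes (yes _) _ = refl
  𝟙-yes (no ¬p) p = contradiction p ¬p

  𝟙-pos : (d : Dec P) → 0 < 𝟙[ d ] → P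
  𝟙-pos (yes p) _ = p

≤-∑ : ∀ {n} (f : Fin n → ℕ) i → f i ≤ ∑[ j < n ] f j
≤-∑ f zero    = m≤m+n _ _
≤-∑ f (suc i) = ≤-trans (≤-∑ (f ∘ suc) i) (m≤n+m _ _)

∑≤n : ∀ {n} (f : Fin n → ℕ) → (∀ i → f i ≤ 1) → ∑[ i < n ] f i ≤ n
∑≤n {zero}  f f≤1 = z≤n
∑≤n {suc n} f f≤1 = +-mono-≤ (f≤1 zero) (∑≤n (f ∘ suc) (f≤1 ∘ suc))

∑≤1 : ∀ {n} (f : Fin n → ℕ) → (∀ i → f i ≤ 1) → (∀ {i j} → 0 < f i → 0 < f j → i ≡ j) →
      ∑[ i < n ] f i ≤ 1
∑≤1 {zero}  f f≤1 unique = z≤n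
∑≤1 {suc n} f f≤1 unique with f zero in f₀≡
... | zero  = ∑≤1 (f ∘ suc) (f≤1 ∘ suc) (λ pos pos′ → Fin.suc-injective (unique pos pos′))
... | suc k = begin
  suc k + ∑[ i < n ] f (suc i) ≡⟨ cong (suc k +_) (trans (sum-cong-≗ tail≡0) (sum-replicate-zero n)) ⟩
  suc k + 0                    ≡⟨ +-identityʳ _ ⟩
  suc k                        ≡⟨ f₀≡ ⟨
  f zero                       ≤⟨ f≤1 zero ⟩
  1                            ∎
  where
  open ≤-Reasoning
  tail≡0 : ∀ i → f (suc i) ≡ 0
  tail≡0 i with f (suc i) in fᵢ≡
  ... | zero  = refl
  ... | suc _ = contradiction (unique (subst (0 <_) (sym f₀≡) z<s) (subst (0 <_) (sym fᵢ≡) z<s)) λ ()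

∑-last : ∀ {n} (f : ℕ → ℕ) → ∑[ i < suc n ] f (toℕ i) ≡ ∑[ i < n ] f (toℕ i) + f n
∑-last {n} f = trans (sum-init-last {n} (f ∘ toℕ))
  (cong₂ _+_ (sum-cong-≗ {n} (cong f ∘ toℕ-inject₁)) (cong f (toℕ-fromℕ n)))

∑-shift : ∀ {n} (f : ℕ → ℕ) → f n ≡ f 0 → ∑[ i < n ] f (suc (toℕ i)) ≡ ∑[ i < n ] f (toℕ i)
∑-shift {zero}  f _      = refl
∑-shift {suc n} f fn≡f0 = begin
  ∑[ i < suc n ] f (suc (toℕ i))    ≡⟨ ∑-last (f ∘ suc) ⟩
  ∑[ i < n ] f (suc (toℕ i)) + f (suc n) ≡⟨ cong (∑[ i < n ] f (suc (toℕ i)) +_) fn≡f0 ⟩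
  ∑[ i < n ] f (suc (toℕ i)) + f 0  ≡⟨ +-comm _ (f 0) ⟩
  ∑[ i < suc n ] f (toℕ i)          ∎
  where open ≡-Reasoning

∑-rotate : ∀ {n} .{{_ : NonZero n}} (f : ℕ → ℕ) c → ∑[ i < n ] f ((toℕ i + c) % n) ≡ ∑[ i < n ] f (toℕ i)
∑-rotate {n} f zero    = sum-cong-≗ λ i → cong f (trans (cong (_% n) (+-identityʳ _)) (m<n⇒m%n≡m (toℕ<n i)))
∑-rotate {n} f (suc c) = begin
  ∑[ i < n ] f ((toℕ i + suc c) % n)   ≡⟨ sum-cong-≗ {n} (λ i → cong (λ x → f (x % n)) (+-suc (toℕ i) c)) ⟩
  ∑[ i < n ] f ((suc (toℕ i) + c) % n) ≡⟨ ∑-shift {n} (λ x → f ((x + c) % n)) (cong f wrap) ⟩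
  ∑[ i < n ] f ((toℕ i + c) % n)       ≡⟨ ∑-rotate f c ⟩
  ∑[ i < n ] f (toℕ i)                 ∎
  where
  open ≡-Reasoning
  wrap : (n + c) % n ≡ (0 + c) % n
  wrap = trans (cong (_% n) (+-comm n c)) ([m+n]%n≡m%n c n)

∑-𝟙-< : ∀ n K → ∑[ i < n ] 𝟙[ toℕ i <? K ] ≡ n ⊓ K
∑-𝟙-< zero    K = refl
∑-𝟙-< (suc n) K = trans (∑-last (λ i → 𝟙[ i <? K ])) (trans (cong (_+ 𝟙[ n <? K ]) (∑-𝟙-< n K)) (last (n <? K)))
  where
  last : (d : Dec (n < K)) → n ⊓ K + 𝟙[ d ] ≡ suc n ⊓ K
  last (yes n<K) = trans (+-comm _ 1) (trans (cong suc (m≤n⇒m⊓n≡m (<⇒≤ n<K))) (sym (m≤n⇒m⊓n≡m n<K)))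
  last (no  n≮K) = trans (+-identityʳ _)
    (trans (m≥n⇒m⊓n≡n (≮⇒≥ n≮K)) (sym (m≥n⇒m⊓n≡n (m≤n⇒m≤1+n (≮⇒≥ n≮K)))))

∑-arc : ∀ {n} .{{_ : NonZero n}} K c → K ≤ n → ∑[ i < n ] 𝟙[ (toℕ i + c) % n <? K ] ≡ K
∑-arc {n} K c K≤n = trans (∑-rotate (λ x → 𝟙[ x <? K ]) c) (trans (∑-𝟙-< n K) (m≥n⇒m⊓n≡n K≤n))

sumᴸ-allFin : ∀ {n} (f : Fin n → ℕ) → sumᴸ (map f (allFin n)) ≡ ∑[ i < n ] f i
sumᴸ-allFin {n} f = trans (cong sumᴸ (map-tabulate id f)) (sumᴸ-tabulate f)
  where
  sumᴸ-tabulate : ∀ {n} (f : Fin n → ℕ) → sumᴸ (tabulate f) ≡ ∑[ i < n ] f i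
  sumᴸ-tabulate {zero}  f = refl
  sumᴸ-tabulate {suc n} f = cong (f zero +_) (sumᴸ-tabulate (f ∘ suc))

-- Packing arcs on a circle

-- An F-point x owns the arc of length K starting at 2x + sF on the circle ℤ/2n, a B-point
-- the one starting at 2x + sB; the separation hypotheses make all these arcs disjoint.
module Packing {n : ℕ} .{{_ : NonZero n}} (K sF sB : ℕ) (F B : ℕ → Set)
  (F-resp : ∀ {x y} → x ≡ y modulo n → F x → F y)
  (B-resp : ∀ {x y} → x ≡ y modulo n → B x → B y)
  (sepFF : ∀ {x d} → 0 < d → F x → F (x + d) → K ≤ 2 * d)
  (sepBB : ∀ {x d} → 0 < d → B x → B (x + d) → K ≤ 2 * d)
  (sepFB : ∀ {x d} → F x → B (x + d) → sF + K ≤ 2 * d + sB)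
  (sepBF : ∀ {x d} → 0 < d → B x → F (x + d) → sB + K ≤ 2 * d + sF)
  where

  private
    M : ℕ
    M = 2 * n
    instance
      M≢0 : NonZero M
      M≢0 = m*n≢0 2 n

  OnArc : ℕ → ℕ → Set
  OnArc s y = gap M s y < K

  arcs-disjoint : ∀ {x x′ d s s′ y} → x + d ≡ x′ modulo n → s + K ≤ 2 * d + s′ → 2 * d + s′ + K ≤ M + s →
                  OnArc (2 * x + s) y → OnArc (2 * x′ + s′) y → ⊥
  arcs-disjoint {x} {x′} {d} {s} {s′} {y} x+d≡x′ before after t<K t′<K = mod-within-period far-≡-near near<far far<near+M
    where
    t  = gap M (2 * x + s) y
    t′ = gap M (2 * x′ + s′) y
    near = s + t
    far  = 2 * d + s′ + t′
    reassoc : ∀ a b c → a + b + c ≡ a + (b + c)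
    reassoc = solve-∀
    expand : ∀ x d s′ t′ → 2 * (x + d) + s′ + t′ ≡ 2 * x + (2 * d + s′ + t′)
    expand = solve-∀
    shifted : 2 * (x + d) + s′ + t′ ≡ 2 * x′ + s′ + t′ modulo M
    shifted = mod-+ʳ t′ (mod-+ʳ s′ (mod-*ˡ 2 x+d≡x′))
    via-y : 2 * x + s + t ≡ 2 * x′ + s′ + t′ modulo M
    via-y = mod-trans (+-gap M _ y) (mod-sym (+-gap M _ y))
    far-≡-near : far ≡ near modulo M
    far-≡-near = mod-cancelˡ (2 * x) (subst₂ (_≡_modulo M) (expand x d s′ t′) (reassoc (2 * x) s t)
                   (mod-trans shifted (mod-sym via-y)))
    near<far : near < far
    near<far = ≤-trans (+-monoʳ-< s t<K) (≤-trans before (m≤m+n _ t′))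
    far<near+M : far < near + M
    far<near+M = ≤-trans (+-monoʳ-< (2 * d + s′) t′<K)
                   (≤-trans after (≤-trans (≤-reflexive (+-comm M s)) (+-monoˡ-≤ M (m≤m+n s t))))

  private
    around : ∀ x {d} → d ≤ n → x + d + (n ∸ d) ≡ x modulo n
    around x {d} d≤n = subst (_≡ x modulo n) (trans (cong (x +_) (sym (m+[n∸m]≡n d≤n))) (sym (+-assoc x d _)))
                         (+-mod x)

    twice-around : ∀ {d} s → d ≤ n → 2 * d + (2 * (n ∸ d) + s) ≡ M + s
    twice-around {d} s d≤n = trans (sym (+-assoc (2 * d) _ s))
      (cong (_+ s) (trans (sym (*-distribˡ-+ 2 d (n ∸ d))) (cong (2 *_) (m+[n∸m]≡n d≤n))))

    same-kind-unique : (P : ℕ → Set) → (∀ {x y} → x ≡ y modulo n → P x → P y) →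
                       (∀ {x d} → 0 < d → P x → P (x + d) → K ≤ 2 * d) → ∀ s {x x′ y} →
                       P x → P x′ → OnArc (2 * x + s) y → OnArc (2 * x′ + s) y → x ≡ x′ modulo n
    same-kind-unique P P-resp sep s {x} {x′} {y} px px′ on on′ with gap n x x′ in d≡
    ... | zero  = subst (_≡ x′ modulo n) (+-identityʳ x) (subst (λ d → x + d ≡ x′ modulo n) d≡ (+-gap n x x′))
    ... | suc _ = contradiction (arcs-disjoint {x} {x′} {d} {s} {s} {y} (+-gap n x x′) before after on on′) λ ()
      where
      d = gap n x x′
      d<n = gap<n n x x′
      K≤2d : K ≤ 2 * d
      K≤2d = sep (subst (0 <_) (sym d≡) z<s) px (P-resp (mod-sym (+-gap n x x′)) px′)
      K≤2e : K ≤ 2 * (n ∸ d)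
      K≤2e = sep (m<n⇒0<n∸m d<n) (P-resp (mod-sym (+-gap n x x′)) px′) (P-resp (mod-sym (around x (<⇒≤ d<n))) px)
      before : s + K ≤ 2 * d + s
      before = subst (_≤ 2 * d + s) (+-comm K s) (+-monoˡ-≤ s K≤2d)
      after : 2 * d + s + K ≤ M + s
      after = begin
        2 * d + s + K         ≡⟨ +-assoc (2 * d) s K ⟩
        2 * d + (s + K)       ≡⟨ cong (2 * d +_) (+-comm s K) ⟩
        2 * d + (K + s)       ≤⟨ +-monoʳ-≤ (2 * d) (+-monoˡ-≤ s K≤2e) ⟩
        2 * d + (2 * (n ∸ d) + s) ≡⟨ twice-around s (<⇒≤ d<n) ⟩
        M + s                 ∎
        where open ≤-Reasoning

  mixed-arcs-disjoint : ∀ {x x′ y} → F x → B x′ → OnArc (2 * x + sF) y → OnArc (2 * x′ + sB) y → ⊥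
  mixed-arcs-disjoint {x} {x′} {y} fx bx′ on on′ = arcs-disjoint {x} {x′} {d} {sF} {sB} {y} (+-gap n x x′) before after on on′
    where
    d = gap n x x′
    d<n = gap<n n x x′
    bxd : B (x + d)
    bxd = B-resp (mod-sym (+-gap n x x′)) bx′
    before : sF + K ≤ 2 * d + sB
    before = sepFB fx bxd
    after : 2 * d + sB + K ≤ M + sF
    after = begin
      2 * d + sB + K                ≡⟨ +-assoc (2 * d) sB K ⟩
      2 * d + (sB + K)              ≤⟨ +-monoʳ-≤ (2 * d) (sepBF (m<n⇒0<n∸m d<n) bxd (F-resp (mod-sym (around x (<⇒≤ d<n))) fx)) ⟩
      2 * d + (2 * (n ∸ d) + sF)    ≡⟨ twice-around sF (<⇒≤ d<n) ⟩
      M + sF                        ∎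
      where open ≤-Reasoning

  module _ (f b : Fin n → ℕ) (f≤1 : ∀ k → f k ≤ 1) (b≤1 : ∀ k → b k ≤ 1)
           (f⇒F : ∀ k → 0 < f k → F (toℕ k)) (b⇒B : ∀ k → 0 < b k → B (toℕ k)) where

    private
      χ : ℕ → Fin M → ℕ
      χ s y = 𝟙[ gap M s (toℕ y) <? K ]

      startF startB : Fin n → ℕ
      startF k = 2 * toℕ k + sF
      startB k = 2 * toℕ k + sB

      φ : Fin n → Fin M → ℕ
      φ k y = f k * χ (startF k) y + b k * χ (startB k) y

      K≤M : ∀ {P : ℕ → Set} → (∀ {x d} → 0 < d → P x → P (x + d) → K ≤ 2 * d) →
            (∀ {x y} → x ≡ y modulo n → P x → P y) → ∀ {x} → P x → K ≤ M
      K≤M sep resp {x} px = sep (>-nonZero⁻¹ n) px (resp (mod-sym (+-mod x)) px)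

      weighted-arc : ∀ c s → (0 < c → K ≤ M) → ∑[ y < M ] (c * χ s y) ≡ c * K
      weighted-arc zero    s _    = sym (*-distribˡ-sum 0 (χ s))
      weighted-arc (suc c) s K≤M′ = trans (sym (*-distribˡ-sum (suc c) (χ s)))
                                          (cong (suc c *_) (∑-arc K ((M ∸ 1) * s) (K≤M′ z<s)))

      occupant : ∀ {k y} → 0 < φ k y →
                 (F (toℕ k) × OnArc (startF k) (toℕ y)) ⊎ (B (toℕ k) × OnArc (startB k) (toℕ y))
      occupant {k} {y} pos with 0<m+n⇒0<m⊎0<n pos
      ... | inj₁ posF = let wf , χf = 0<m*n⇒0<m×0<n posF in inj₁ (f⇒F k wf , 𝟙-pos (gap M _ (toℕ y) <? K) χf)
      ... | inj₂ posB = let wb , χb = 0<m*n⇒0<m×0<n posB in inj₂ (b⇒B k wb , 𝟙-pos (gap M _ (toℕ y) <? K) χb)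

      same-point : ∀ {k k′ y} →
                   (F (toℕ k) × OnArc (startF k) y) ⊎ (B (toℕ k) × OnArc (startB k) y) →
                   (F (toℕ k′) × OnArc (startF k′) y) ⊎ (B (toℕ k′) × OnArc (startB k′) y) →
                   toℕ k ≡ toℕ k′ modulo n
      same-point (inj₁ (fk , on)) (inj₁ (fk′ , on′)) = same-kind-unique F F-resp sepFF sF fk fk′ on on′
      same-point (inj₂ (bk , on)) (inj₂ (bk′ , on′)) = same-kind-unique B B-resp sepBB sB bk bk′ on on′
      same-point (inj₁ (fk , on)) (inj₂ (bk′ , on′)) = contradiction (mixed-arcs-disjoint fk bk′ on on′) λ ()
      same-point (inj₂ (bk , on)) (inj₁ (fk′ , on′)) = contradiction (mixed-arcs-disjoint fk′ bk on′ on) λ ()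

      part≤1 : ∀ {c} → c ≤ 1 → ∀ s y → c * χ s y ≤ 1
      part≤1 c≤1 s y = *-mono-≤ c≤1 (𝟙≤1 (gap M s (toℕ y) <? K))

      row-sum : ∀ k → ∑[ y < M ] φ k y ≡ (f k + b k) * K
      row-sum k = begin
        ∑[ y < M ] φ k y                   ≡⟨ ∑-distrib-+ (λ y → f k * χ (startF k) y) (λ y → b k * χ (startB k) y) ⟩
        ∑[ y < M ] (f k * χ (startF k) y) + ∑[ y < M ] (b k * χ (startB k) y)
          ≡⟨ cong₂ _+_ (weighted-arc (f k) (startF k) (K≤M sepFF F-resp ∘ f⇒F k))
                       (weighted-arc (b k) (startB k) (K≤M sepBB B-resp ∘ b⇒B k)) ⟩
        f k * K + b k * K                  ≡⟨ *-distribʳ-+ K (f k) (b k) ⟨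
        (f k + b k) * K                    ∎
        where open ≡-Reasoning

      column-sum : ∀ y → ∑[ k < n ] φ k y ≤ 1
      column-sum y = ∑≤1 (λ k → φ k y)
        (λ k → m+n≤1 (part≤1 (f≤1 k) (startF k) y) (part≤1 (b≤1 k) (startB k) y) λ posF posB →
           let wf , χf = 0<m*n⇒0<m×0<n posF ; wb , χb = 0<m*n⇒0<m×0<n posB in
           mixed-arcs-disjoint (f⇒F k wf) (b⇒B k wb) (𝟙-pos (gap M _ (toℕ y) <? K) χf) (𝟙-pos (gap M _ (toℕ y) <? K) χb))
        (λ pos pos′ → toℕ-injective (mod-<⇒≡ (toℕ<n _) (toℕ<n _) (same-point (occupant pos) (occupant pos′))))

    packing : (∑[ k < n ] (f k + b k)) * K ≤ M
    packing = begin
      (∑[ k < n ] (f k + b k)) * K       ≡⟨ *-distribʳ-sum K (λ k → f k + b k) ⟩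
      ∑[ k < n ] ((f k + b k) * K)       ≡⟨ sum-cong-≗ {n} row-sum ⟨
      ∑[ k < n ] ∑[ y < M ] φ k y        ≡⟨ ∑-comm φ ⟩
      ∑[ y < M ] ∑[ k < n ] φ k y        ≤⟨ ∑≤n (λ y → ∑[ k < n ] φ k y) column-sum ⟩
      M                                  ∎
      where open ≤-Reasoning

mod-toℕ : ∀ {n} (k : Fin (suc n)) → toℕ k mod suc n ≡ k
mod-toℕ {n} k = trans (fromℕ<-cong _ _ (m<n⇒m%n≡m (toℕ<n k)) _ (toℕ<n k)) (fromℕ<-toℕ k (toℕ<n k))

toℕ-mod : ∀ m y → toℕ (y mod suc m) ≡ y modulo suc m
toℕ-mod m y = subst (_≡ y modulo suc m) (sym (toℕ-fromℕ< (m%n<n y (suc m)))) (%-mod y)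

_⟦_⟧ : ∀ {m} → Grid m → ℕ → ℕ
_⟦_⟧ {m} Γ y = Γ (y mod suc m)

module _ {m : ℕ} (Γ : Grid m) where

  private
    n = suc m

  ⟦⟧-mod : ∀ {x y} → x ≡ y modulo n → Γ ⟦ x ⟧ ≡ Γ ⟦ y ⟧
  ⟦⟧-mod x≡y = cong Γ (fromℕ<-cong _ _ (mod⇒%≡ x≡y) _ _)

  appearance⇔ : ∀ w p v → isAppearance w m Γ p v ⇔ (∀ {i} → i < length w → Γ (pos m p v i) ≡ w ! i)
  appearance⇔ w p v = mk⇔
    (λ app {i} i<w → trans (sym (read! i<w)) (cong (_! i) app))
    (λ reads → !-ext (readLength) λ {i} i<r → let i<w = subst (i <_) readLength i<r in trans (read! i<w) (reads i<w))
    where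
    read! : ∀ {i} → i < length w → readAt m Γ p v (length w) ! i ≡ Γ (pos m p v i)
    read! i<w = trans (cong (_! _) (map-upTo _ (length w))) (!-applyUpTo _ i<w)
    readLength : length (readAt m Γ p v (length w)) ≡ length w
    readLength = trans (cong length (map-upTo _ (length w))) (length-applyUpTo _ (length w))

  appearance? : ∀ w p v → Dec (isAppearance w m Γ p v)
  appearance? w p v = readAt m Γ p v (length w) ≟w w

  appearances≡∑ : ∀ w → appearances w m Γ ≡ ∑[ p < n ] (𝟙[ appearance? w p fwd ] + 𝟙[ appearance? w p bwd ])
  appearances≡∑ w = trans (sumᴸ-allFin {n} λ p → 𝟙[ appearance? w p fwd ] + (𝟙[ appearance? w p bwd ] + 0))
    (sum-cong-≗ {n} λ p → cong (𝟙[ appearance? w p fwd ] +_) (+-identityʳ 𝟙[ appearance? w p bwd ]))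

  pos-bwd : ∀ {p y i} → toℕ p ≡ y + i modulo n → Γ (pos m p bwd i) ≡ Γ ⟦ y ⟧
  pos-bwd {p} {y} {i} p≡ = ⟦⟧-mod (mod-trans (mod-+ʳ (m * i) p≡) (+-+pred*-mod m y i))

  record ReadsAt (w : Word) (x : ℕ) : Set where
    constructor reads
    field letter : ∀ {j} → j < length w → Γ ⟦ x + j ⟧ ≡ w ! j

  record ReadsReversedAt (w : Word) (x : ℕ) : Set where
    constructor readsReversed
    field letter : ∀ {j} → j < length w → Γ ⟦ x + j ⟧ ≡ w ! (length w ∸ suc j)

  readsAt-mod : ∀ {w x y} → x ≡ y modulo n → ReadsAt w x → ReadsAt w y
  readsAt-mod x≡y (reads r) = reads λ j<w → trans (⟦⟧-mod (mod-+ʳ _ (mod-sym x≡y))) (r j<w)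

  readsReversedAt-mod : ∀ {w x y} → x ≡ y modulo n → ReadsReversedAt w x → ReadsReversedAt w y
  readsReversedAt-mod x≡y (readsReversed r) = readsReversed λ j<w → trans (⟦⟧-mod (mod-+ʳ _ (mod-sym x≡y))) (r j<w)

  forward⇒readsAt : ∀ {w p} → isAppearance w m Γ p fwd → ReadsAt w (toℕ p)
  forward⇒readsAt {w} {p} app = reads (Equivalence.to (appearance⇔ w p fwd) app)

  backward⇒readsReversedAt : ∀ {w p x} → x + (length w ∸ 1) ≡ toℕ p modulo n →
                             isAppearance w m Γ p bwd → ReadsReversedAt w x
  backward⇒readsReversedAt {w} {p} {x} x+ℓ-1≡p app =
    readsReversed λ {j} j<w → trans (sym (pos-bwd (p≡ j<w))) (Equivalence.to (appearance⇔ w p bwd) app (n∸suc[m]<n j<w))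
    where
    p≡ : ∀ {j} → j < length w → toℕ p ≡ x + j + (length w ∸ suc j) modulo n
    p≡ {j} j<w = subst (toℕ p ≡_modulo n)
      (trans (cong (x +_) (trans (n∸1≡[n∸suc[m]]+m j<w) (+-comm _ j))) (sym (+-assoc x j _)))
                   (mod-sym x+ℓ-1≡p)

module _ {m : ℕ} (Γ : Grid m) (w : Word) where

  private
    n = suc m

  appearances≡∑+∑ : appearances w m Γ ≡ ∑[ p < n ] 𝟙[ appearance? Γ w p fwd ] + ∑[ p < n ] 𝟙[ appearance? Γ w p bwd ]
  appearances≡∑+∑ = trans (appearances≡∑ Γ w)
    (∑-distrib-+ (λ p → 𝟙[ appearance? Γ w p fwd ]) (λ p → 𝟙[ appearance? Γ w p bwd ]))

  forward⇒1≤appearances : ∀ p → isAppearance w m Γ p fwd → 1 ≤ appearances w m Γ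
  forward⇒1≤appearances p app = begin
    1                                             ≡⟨ 𝟙-yes (appearance? Γ w p fwd) app ⟨
    𝟙[ appearance? Γ w p fwd ]                    ≤⟨ ≤-∑ (λ p → 𝟙[ appearance? Γ w p fwd ]) p ⟩
    ∑[ p < n ] 𝟙[ appearance? Γ w p fwd ]         ≤⟨ m≤m+n _ _ ⟩
    _                                             ≡⟨ appearances≡∑+∑ ⟨
    appearances w m Γ                             ∎
    where open ≤-Reasoning

  forward-backward⇒2≤appearances : ∀ p p′ → isAppearance w m Γ p fwd → isAppearance w m Γ p′ bwd →
                                   2 ≤ appearances w m Γ
  forward-backward⇒2≤appearances p p′ app app′ = begin
    2   ≡⟨ cong₂ _+_ (𝟙-yes (appearance? Γ w p fwd) app) (𝟙-yes (appearance? Γ w p′ bwd) app′) ⟨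
    𝟙[ appearance? Γ w p fwd ] + 𝟙[ appearance? Γ w p′ bwd ]
      ≤⟨ +-mono-≤ (≤-∑ (λ p → 𝟙[ appearance? Γ w p fwd ]) p) (≤-∑ (λ p → 𝟙[ appearance? Γ w p bwd ]) p′) ⟩
    _                                             ≡⟨ appearances≡∑+∑ ⟨
    appearances w m Γ                             ∎
    where open ≤-Reasoning

module _ {m : ℕ} (Γ : Grid m) (w : Word) where

  private
    ℓ = length w

    shortened : ∀ {d i} → i < ℓ ∸ d → i < ℓ
    shortened {d} i<ℓ-d = ≤-trans i<ℓ-d (m∸n≤m ℓ d)

    ℓ∸[ℓ∸d] : ∀ {d} → d < ℓ → ℓ ∸ (ℓ ∸ d) ≡ d
    ℓ∸[ℓ∸d] d<ℓ = m∸[m∸n]≡n (<⇒≤ d<ℓ)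

    shorter : ∀ {d} → 0 < d → d < ℓ → ℓ ∸ d < ℓ
    shorter 0<d d<ℓ = ∸-monoʳ-< 0<d (<⇒≤ d<ℓ)

  readsAt-overlap : ∀ {x d} → 0 < d → ReadsAt Γ w x → ReadsAt Γ w (x + d) → ℓ ∸ cRepeat w ≤ d
  readsAt-overlap {x} {d} 0<d (reads r) (reads r′) = [n<m⇒m∸n≤o]⇒m∸o≤n ℓ λ d<ℓ →
    cRepeat-greatest w (shorter 0<d d<ℓ) λ {i} i<ℓ-d → begin
      w ! i                  ≡⟨ r′ (shortened {d} i<ℓ-d) ⟨
      Γ ⟦ x + d + i ⟧        ≡⟨ cong (Γ ⟦_⟧) (+-assoc x d i) ⟩
      Γ ⟦ x + (d + i) ⟧      ≡⟨ r (m<o∸n⇒n+m<o (<⇒≤ d<ℓ) i<ℓ-d) ⟩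
      w ! (d + i)            ≡⟨ cong (λ k → w ! (k + i)) (ℓ∸[ℓ∸d] d<ℓ) ⟨
      w ! (ℓ ∸ (ℓ ∸ d) + i)  ∎
    where open ≡-Reasoning

  readsReversedAt-overlap : ∀ {x d} → 0 < d → ReadsReversedAt Γ w x → ReadsReversedAt Γ w (x + d) → ℓ ∸ cRepeat w ≤ d
  readsReversedAt-overlap {x} {d} 0<d (readsReversed r) (readsReversed r′) = [n<m⇒m∸n≤o]⇒m∸o≤n ℓ λ d<ℓ →
    cRepeat-greatest w (shorter 0<d d<ℓ) λ {i} i<ℓ-d →
      let d+i<ℓ = m<o∸n⇒n+m<o (<⇒≤ d<ℓ) i<ℓ-d
          j = ℓ ∸ suc (d + i)
          d+i+[1+j]≡ℓ : d + i + suc j ≡ ℓ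
          d+i+[1+j]≡ℓ = m+suc[n∸suc[m]]≡n d+i<ℓ
          i+[1+d+j]≡ℓ : i + suc (d + j) ≡ ℓ
          i+[1+d+j]≡ℓ = trans (cong (i +_) (sym (+-suc d j))) (trans (+-comm-middle i d (suc j)) d+i+[1+j]≡ℓ)
      in begin
      w ! i                  ≡⟨ cong (w !_) (m+suc[n]≡o⇒o∸suc[n]≡m i+[1+d+j]≡ℓ) ⟨
      w ! (ℓ ∸ suc (d + j))  ≡⟨ r (subst (d + j <_) i+[1+d+j]≡ℓ (m≤n+m (suc (d + j)) i)) ⟨
      Γ ⟦ x + (d + j) ⟧      ≡⟨ cong (Γ ⟦_⟧) (+-assoc x d j) ⟨
      Γ ⟦ x + d + j ⟧        ≡⟨ r′ (subst (j <_) d+i+[1+j]≡ℓ (m≤n+m (suc j) (d + i))) ⟩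
      w ! (ℓ ∸ suc j)        ≡⟨ cong (w !_) (m+suc[n]≡o⇒o∸suc[n]≡m d+i+[1+j]≡ℓ) ⟩
      w ! (d + i)            ≡⟨ cong (λ k → w ! (k + i)) (ℓ∸[ℓ∸d] d<ℓ) ⟨
      w ! (ℓ ∸ (ℓ ∸ d) + i)  ∎
    where
    open ≡-Reasoning
    +-comm-middle : ∀ a b c → a + (b + c) ≡ b + a + c
    +-comm-middle a b c = trans (sym (+-assoc a b c)) (cong (_+ c) (+-comm a b))

  readsAt-readsReversedAt : ∀ {x d} → ReadsAt Γ w x → ReadsReversedAt Γ w (x + d) → ℓ ∸ cRight w ≤ d
  readsAt-readsReversedAt {x} {d} (reads r) (readsReversed r′) = [n<m⇒m∸n≤o]⇒m∸o≤n ℓ λ d<ℓ →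
    cRight-greatest w (m∸n≤m ℓ d) λ {i} i<ℓ-d → begin
      w ! (ℓ ∸ (ℓ ∸ d) + i)  ≡⟨ cong (λ k → w ! (k + i)) (ℓ∸[ℓ∸d] d<ℓ) ⟩
      w ! (d + i)            ≡⟨ r (m<o∸n⇒n+m<o (<⇒≤ d<ℓ) i<ℓ-d) ⟨
      Γ ⟦ x + (d + i) ⟧      ≡⟨ cong (Γ ⟦_⟧) (+-assoc x d i) ⟨
      Γ ⟦ x + d + i ⟧        ≡⟨ r′ (shortened {d} i<ℓ-d) ⟩
      w ! (ℓ ∸ suc i)        ∎
    where open ≡-Reasoning

  readsReversedAt-readsAt : ∀ {x d} → ReadsReversedAt Γ w x → ReadsAt Γ w (x + d) → ℓ ∸ cLeft w ≤ d
  readsReversedAt-readsAt {x} {d} (readsReversed r) (reads r′) = [n<m⇒m∸n≤o]⇒m∸o≤n ℓ λ d<ℓ →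
    cLeft-greatest w (m∸n≤m ℓ d) λ {i} i<ℓ-d → begin
      w ! i                  ≡⟨ r′ (shortened {d} i<ℓ-d) ⟨
      Γ ⟦ x + d + i ⟧        ≡⟨ cong (Γ ⟦_⟧) (+-assoc x d i) ⟩
      Γ ⟦ x + (d + i) ⟧      ≡⟨ r (m<o∸n⇒n+m<o (<⇒≤ d<ℓ) i<ℓ-d) ⟩
      w ! (ℓ ∸ suc (d + i))  ≡⟨ cong (λ k → w ! (ℓ ∸ k)) (+-suc d i) ⟨
      w ! (ℓ ∸ (d + suc i))  ≡⟨ cong (w !_) (∸-+-assoc ℓ d (suc i)) ⟨
      w ! (ℓ ∸ d ∸ suc i)    ∎
    where open ≡-Reasoning

-- Upper bounds

module _ {m : ℕ} (Γ : Grid m) (w : Word) where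

  private
    n = suc m
    ℓ = length w

    forward? : ∀ p → Dec (isAppearance w m Γ p fwd)
    forward? p = appearance? Γ w p fwd

    backward? : ∀ p → Dec (isAppearance w m Γ p bwd)
    backward? p = appearance? Γ w p bwd

    -- The reversed word of a backward appearance at p starts at p − (ℓ − 1).
    shift : Fin n → ℕ
    shift k = (toℕ k + (ℓ ∸ 1)) % n

  appearances≡∑-shifted : appearances w m Γ ≡ ∑[ k < n ] (𝟙[ forward? k ] + 𝟙[ backward? (shift k mod n) ])
  appearances≡∑-shifted = begin
    appearances w m Γ                         ≡⟨ appearances≡∑ Γ w ⟩
    ∑[ k < n ] (f k + 𝟙[ backward? k ])       ≡⟨ ∑-distrib-+ f (λ k → 𝟙[ backward? k ]) ⟩
    ∑[ k < n ] f k + ∑[ k < n ] 𝟙[ backward? k ]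
      ≡⟨ cong (∑[ k < n ] f k +_) (sum-cong-≗ {n} λ k → cong (λ p → 𝟙[ backward? p ]) (mod-toℕ k)) ⟨
    ∑[ k < n ] f k + ∑[ k < n ] 𝟙[ backward? (toℕ k mod n) ]
      ≡⟨ cong (∑[ k < n ] f k +_) (∑-rotate (λ z → 𝟙[ backward? (z mod n) ]) (ℓ ∸ 1)) ⟨
    ∑[ k < n ] f k + ∑[ k < n ] b k           ≡⟨ ∑-distrib-+ f b ⟨
    ∑[ k < n ] (f k + b k)                    ∎
    where
    open ≡-Reasoning
    f b : Fin n → ℕ
    f k = 𝟙[ forward? k ]
    b k = 𝟙[ backward? (shift k mod n) ]

  appearances-packing : ∀ K sF sB →
    (∀ {x d} → 0 < d → ReadsAt Γ w x → ReadsAt Γ w (x + d) → K ≤ 2 * d) →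
    (∀ {x d} → 0 < d → ReadsReversedAt Γ w x → ReadsReversedAt Γ w (x + d) → K ≤ 2 * d) →
    (∀ {x d} → ReadsAt Γ w x → ReadsReversedAt Γ w (x + d) → sF + K ≤ 2 * d + sB) →
    (∀ {x d} → 0 < d → ReadsReversedAt Γ w x → ReadsAt Γ w (x + d) → sB + K ≤ 2 * d + sF) →
    appearances w m Γ * K ≤ 2 * n
  appearances-packing K sF sB sepFF sepBB sepFB sepBF = subst (λ N → N * K ≤ 2 * n) (sym appearances≡∑-shifted)
    (packing (λ k → 𝟙[ forward? k ]) (λ k → 𝟙[ backward? (shift k mod n) ])
             (𝟙≤1 ∘ forward?) (λ k → 𝟙≤1 (backward? (shift k mod n))) f⇒F b⇒B)
    where
    open Packing K sF sB (ReadsAt Γ w) (ReadsReversedAt Γ w) (readsAt-mod Γ {w}) (readsReversedAt-mod Γ {w})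
                 sepFF sepBB sepFB sepBF
    f⇒F : ∀ k → 0 < 𝟙[ forward? k ] → ReadsAt Γ w (toℕ k)
    f⇒F k pos = forward⇒readsAt Γ {w} {k} (𝟙-pos (forward? k) pos)
    b⇒B : ∀ k → 0 < 𝟙[ backward? (shift k mod n) ] → ReadsReversedAt Γ w (toℕ k)
    b⇒B k pos = backward⇒readsReversedAt Γ k+ℓ-1≡p (𝟙-pos (backward? (shift k mod n)) pos)
      where
      k+ℓ-1≡p : toℕ k + (ℓ ∸ 1) ≡ toℕ (shift k mod n) modulo n
      k+ℓ-1≡p = mod-sym (mod-trans (toℕ-mod m (shift k)) (%-mod (toℕ k + (ℓ ∸ 1))))

  appearances-bound-nonPalindrome : let a = ℓ ∸ cRepeat w ; b = (ℓ ∸ cLeft w) + (ℓ ∸ cRight w) in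
                                    appearances w m Γ * (2 * a ⊓ b) ≤ 2 * n
  appearances-bound-nonPalindrome = appearances-packing K (2 * c) K
    (λ 0<d r r′ → ≤-trans (m⊓n≤m _ _) (*-monoʳ-≤ 2 (readsAt-overlap Γ w 0<d r r′)))
    (λ 0<d r r′ → ≤-trans (m⊓n≤m _ _) (*-monoʳ-≤ 2 (readsReversedAt-overlap Γ w 0<d r r′)))
    (λ r r′ → +-monoˡ-≤ K (*-monoʳ-≤ 2 (readsAt-readsReversedAt Γ w r r′)))
    λ {x} {d} _ r r′ →
      let K≤d+c = ≤-trans (m⊓n≤n (2 * a) (ℓ ∸ cLeft w + c)) (+-monoˡ-≤ c (readsReversedAt-readsAt Γ w r r′))
      in subst (K + K ≤_) (double d c) (+-mono-≤ K≤d+c K≤d+c)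
    where
    a = ℓ ∸ cRepeat w
    c = ℓ ∸ cRight w
    K = 2 * a ⊓ (ℓ ∸ cLeft w + c)
    double : ∀ d c → d + c + (d + c) ≡ 2 * d + 2 * c
    double = solve-∀

  appearances-bound-palindrome : Palindrome w → appearances w m Γ * (ℓ ∸ cRepeat w) ≤ 2 * n
  appearances-bound-palindrome pal = appearances-packing a 0 a
    (λ 0<d r r′ → a≤2d (readsAt-overlap Γ w 0<d r r′))
    (λ 0<d r r′ → a≤2d (readsAt-overlap Γ w 0<d (forward r) (forward r′)))
    (λ {x} {d} _ _ → m≤n+m a (2 * d))
    λ {x} {d} 0<d r r′ → let a≤d = readsAt-overlap Γ w 0<d (forward r) r′ in
      subst (a + a ≤_) (double d) (+-mono-≤ a≤d a≤d)
    where
    a = ℓ ∸ cRepeat w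
    a≤2d : ∀ {d} → a ≤ d → a ≤ 2 * d
    a≤2d {d} a≤d = ≤-trans a≤d (m≤m+n d (d + 0))
    double : ∀ d → d + d ≡ 2 * d + 0
    double = solve-∀
    forward : ∀ {x} → ReadsReversedAt Γ w x → ReadsAt Γ w x
    forward (readsReversed r) =
      reads λ j<ℓ → trans (r j<ℓ) (sym (Equivalence.to (palindrome⇔palindromicPrefix w) pal j<ℓ))

-- Lower bounds

HasPeriod : Word → ℕ → Set
HasPeriod w d = ∀ {i} → i + d < length w → w ! (i + d) ≡ w ! i

module _ (w : Word) {d : ℕ} (period : HasPeriod w d) where

  period-* : ∀ r q → r + q * d < length w → w ! (r + q * d) ≡ w ! r
  period-* r zero    _  = cong (w !_) (+-identityʳ r)
  period-* r (suc q) lt = trans (cong (w !_) (regroup r q d)) (trans (period (subst (_< length w) (regroup r q d) lt))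
                                (period-* r q (≤-<-trans (m≤m+n _ d) (subst (_< length w) (regroup r q d) lt))))
    where
    regroup : ∀ r q d → r + suc q * d ≡ r + q * d + d
    regroup = solve-∀

  period-% : .{{_ : NonZero d}} → ∀ {i} → i < length w → w ! (i % d) ≡ w ! i
  period-% {i} i<w = sym (trans (cong (w !_) i≡) (period-* (i % d) (i / d) (subst (_< length w) i≡ i<w)))
    where
    i≡ : i ≡ i % d + (i / d) * d
    i≡ = m≡m%n+[m/n]*n i d

  period-mod : .{{_ : NonZero d}} → ∀ {i j} → i < length w → j < length w → i ≡ j modulo d → w ! i ≡ w ! j
  period-mod i<w j<w i≡j = trans (sym (period-% i<w)) (trans (cong (w !_) (mod⇒%≡ i≡j)) (period-% j<w))

cRepeat-period : ∀ w → 0 < length w → HasPeriod w (length w ∸ cRepeat w)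
cRepeat-period w 0<w {i} i+a<w = sym (trans (border i<c) (cong (w !_) (+-comm a i)))
  where
  a = length w ∸ cRepeat w
  border = proj₁ (cRepeat-spec w 0<w)
  c+a≡ℓ : cRepeat w + a ≡ length w
  c+a≡ℓ = m+[n∸m]≡n (<⇒≤ (proj₂ (cRepeat-spec w 0<w)))
  i<c : i < cRepeat w
  i<c = +-cancelʳ-< a i (cRepeat w) (subst (i + a <_) (sym c+a≡ℓ) i+a<w)

module PeriodicGrid (w : Word) {m : ℕ} (period : HasPeriod w (suc m)) where

  private
    n = suc m
    ℓ = length w

  Γ : Grid m
  Γ x = w ! toℕ x

  ⟦⟧-periodic : ∀ {y} → y < ℓ → Γ ⟦ y ⟧ ≡ w ! y
  ⟦⟧-periodic {y} y<ℓ = trans (cong (w !_) (toℕ-fromℕ< (m%n<n y n))) (period-% w period y<ℓ)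

  forward : isAppearance w m Γ zero fwd
  forward = Equivalence.from (appearance⇔ Γ w zero fwd) ⟦⟧-periodic

  backward : Palindrome w → isAppearance w m Γ ((ℓ ∸ 1) mod n) bwd
  backward pal = Equivalence.from (appearance⇔ Γ w ((ℓ ∸ 1) mod n) bwd) λ {i} i<ℓ → begin
    Γ (pos m ((ℓ ∸ 1) mod n) bwd i)
      ≡⟨ pos-bwd Γ {(ℓ ∸ 1) mod n} (mod-trans (toℕ-mod m (ℓ ∸ 1)) (≡⇒mod (n∸1≡[n∸suc[m]]+m i<ℓ))) ⟩
    Γ ⟦ ℓ ∸ suc i ⟧                  ≡⟨ ⟦⟧-periodic (n∸suc[m]<n i<ℓ) ⟩
    w ! (ℓ ∸ suc i)                  ≡⟨ Equivalence.to (palindrome⇔palindromicPrefix w) pal i<ℓ ⟨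
    w ! i                            ∎
    where open ≡-Reasoning

  1≤appearances : 1 ≤ appearances w m Γ
  1≤appearances = forward⇒1≤appearances Γ w zero forward

  2≤appearances : Palindrome w → 2 ≤ appearances w m Γ
  2≤appearances pal = forward-backward⇒2≤appearances Γ w zero ((ℓ ∸ 1) mod n) forward (backward pal)

module ReflectingGrid (w : Word) {L R m : ℕ} (L≤ℓ : L ≤ length w) (R≤ℓ : R ≤ length w) (0<L : 0 < L)
  (prefix : PalindromicPrefix w L) (suffix : PalindromicSuffix w R)
  (n≡ : suc m ≡ (length w ∸ L) + (length w ∸ R)) where

  private
    n = suc m
    ℓ = length w
    p = ℓ ∸ L
    q = ℓ ∸ R

    L+p≡ℓ : L + p ≡ ℓ
    L+p≡ℓ = m+[n∸m]≡n L≤ℓ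

    q+R≡ℓ : q + R ≡ ℓ
    q+R≡ℓ = trans (+-comm q R) (m+[n∸m]≡n R≤ℓ)

    L+n≡q+ℓ : L + n ≡ q + ℓ
    L+n≡q+ℓ = begin
      L + n        ≡⟨ cong (L +_) n≡ ⟩
      L + (p + q)  ≡⟨ +-assoc L p q ⟨
      L + p + q    ≡⟨ cong (_+ q) L+p≡ℓ ⟩
      ℓ + q        ≡⟨ +-comm ℓ q ⟩
      q + ℓ        ∎
      where open ≡-Reasoning

    ℓ≤L+n : ℓ ≤ L + n
    ℓ≤L+n = subst (_≤ L + n) L+p≡ℓ (+-monoʳ-≤ L (subst (p ≤_) (sym n≡) (m≤m+n p q)))

  prefix-mirror : ∀ {i j} → i + suc j ≡ L → w ! i ≡ w ! j
  prefix-mirror {i} {j} eq = trans (prefix (subst (i <_) eq (m<m+n i z<s)))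
                                   (cong (w !_) (m+suc[n]≡o⇒o∸suc[n]≡m (trans (m+suc[n]≡n+suc[m] j i) eq)))

  suffix-mirror : ∀ {i j} → i < ℓ → j < ℓ → i + suc j ≡ L + n → w ! i ≡ w ! j
  suffix-mirror {i} {j} i<ℓ j<ℓ eq = begin
    w ! i              ≡⟨ cong (w !_) (m+[n∸m]≡n q≤i) ⟨
    w ! (q + k)        ≡⟨ suffix k<R ⟩
    w ! (ℓ ∸ suc k)    ≡⟨ cong (w !_) (m+suc[n]≡o⇒o∸suc[n]≡m (trans (m+suc[n]≡n+suc[m] j k) k+[1+j]≡ℓ)) ⟩
    w ! j              ∎
    where
    open ≡-Reasoning
    i+[1+j]≡q+ℓ = trans eq L+n≡q+ℓ
    q≤i : q ≤ i
    q≤i = +-cancelʳ-≤ (suc j) q i (subst (q + suc j ≤_) (sym i+[1+j]≡q+ℓ) (+-monoʳ-≤ q j<ℓ))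
    k = i ∸ q
    k<R : k < R
    k<R = +-cancelˡ-< q k R (subst₂ _<_ (sym (m+[n∸m]≡n q≤i)) (sym q+R≡ℓ) i<ℓ)
    k+[1+j]≡ℓ : k + suc j ≡ ℓ
    k+[1+j]≡ℓ = +-cancelˡ-≡ q _ _ (trans (sym (+-assoc q k (suc j))) (trans (cong (_+ suc j) (m+[n∸m]≡n q≤i)) i+[1+j]≡q+ℓ))

  mirror-cancel : ∀ {i j k} → i + suc j ≡ L modulo n → i + suc k ≡ L modulo n → j ≡ k modulo n
  mirror-cancel {i} ij ik = mod-cancelˡ 1 (mod-cancelˡ i (mod-trans ij (mod-sym ik)))

  -- The reflections i ↦ L − 1 − i and i ↦ L + n − 1 − i compose to the shift by n.
  period : HasPeriod w n
  period {i} i+n<ℓ = sym (trans (prefix-mirror i+[1+j]≡L) (suffix-mirror j<ℓ i+n<ℓ j+[1+i+n]≡L+n))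
    where
    i<L : i < L
    i<L = +-cancelʳ-< n i L (<-≤-trans i+n<ℓ ℓ≤L+n)
    j = L ∸ suc i
    i+[1+j]≡L : i + suc j ≡ L
    i+[1+j]≡L = m+suc[n∸suc[m]]≡n i<L
    j<ℓ : j < ℓ
    j<ℓ = <-≤-trans (n∸suc[m]<n i<L) L≤ℓ
    j+[1+i+n]≡L+n : j + suc (i + n) ≡ L + n
    j+[1+i+n]≡L+n = trans (sym (+-assoc j (suc i) n)) (cong (_+ n) (trans (m+suc[n]≡n+suc[m] j i) i+[1+j]≡L))

  mirror-mod : ∀ {i j} → i < ℓ → j < ℓ → i + suc j ≡ L modulo n → w ! i ≡ w ! j
  mirror-mod {i} {j} i<ℓ j<ℓ i+[1+j]≡L with i <? L | q ≤? i
  ... | yes i<L | _ = trans (prefix-mirror i+[1+i′]≡L)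
                            (period-mod w period i′<ℓ j<ℓ (mirror-cancel (≡⇒mod i+[1+i′]≡L) i+[1+j]≡L))
    where
    i′ = L ∸ suc i
    i+[1+i′]≡L = m+suc[n∸suc[m]]≡n i<L
    i′<ℓ = <-≤-trans (n∸suc[m]<n i<L) L≤ℓ
  ... | no _ | yes q≤i = trans (suffix-mirror i<ℓ i′<ℓ i+[1+i′]≡L+n)
                                (period-mod w period i′<ℓ j<ℓ (mirror-cancel (mod-trans (≡⇒mod i+[1+i′]≡L+n) (+-mod L)) i+[1+j]≡L))
    where
    i′ = L + n ∸ suc i
    i+[1+i′]≡L+n : i + suc i′ ≡ L + n
    i+[1+i′]≡L+n = m+suc[n∸suc[m]]≡n (<-≤-trans i<ℓ ℓ≤L+n)
    i′<ℓ : i′ < ℓ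
    i′<ℓ = +-cancelˡ-≤ q (suc i′) ℓ (≤-trans (+-monoˡ-≤ (suc i′) q≤i) (≤-reflexive (trans i+[1+i′]≡L+n L+n≡q+ℓ)))
  -- For L ≤ i < q the sum i + j + 1 lies strictly between L and L + 2n.
  ... | no i≮L | no q≰i with <-cmp (i + suc j) (L + n)
  ...   | tri≈ _ X≡L+n _ = suffix-mirror i<ℓ j<ℓ X≡L+n
  ...   | tri< X<L+n _ _ = contradiction (mod-within-period i+[1+j]≡L L<X X<L+n) λ ()
    where
    L<X : L < i + suc j
    L<X = ≤-<-trans (≮⇒≥ i≮L) (m<m+n i z<s)
  ...   | tri> _ _ X>L+n = contradiction (mod-within-period (mod-trans i+[1+j]≡L (mod-sym (+-mod L))) X>L+n X<L+n+n) λ ()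
    where
    ℓ≤n : ℓ ≤ n
    ℓ≤n = subst₂ _≤_ L+p≡ℓ (trans (+-comm q p) (sym n≡)) (+-monoˡ-≤ p (≤-trans (≮⇒≥ i≮L) (<⇒≤ (≰⇒> q≰i))))
    X<L+n+n : i + suc j < L + n + n
    X<L+n+n = +-mono-<-≤ (<-≤-trans i<ℓ ℓ≤L+n) (≤-trans j<ℓ ℓ≤n)

  representative : ℕ → ℕ
  representative z = if ⌊ z <? ℓ ⌋ then z else L + n ∸ suc z

  representative-spec : ∀ {z} → z < n → representative z < ℓ × (representative z ≡ z ⊎ representative z + suc z ≡ L + n)
  representative-spec {z} z<n with z <? ℓ
  ... | yes z<ℓ = z<ℓ , inj₁ refl
  ... | no  z≮ℓ = r<ℓ , inj₂ r+[1+z]≡L+n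
    where
    r = L + n ∸ suc z
    r+[1+z]≡L+n : r + suc z ≡ L + n
    r+[1+z]≡L+n = trans (m+suc[n]≡n+suc[m] r z) (m+suc[n∸suc[m]]≡n (≤-trans z<n (m≤n+m n L)))
    r<ℓ : r < ℓ
    r<ℓ = ≤-trans (+-cancelʳ-≤ ℓ (suc r) q (≤-trans (+-monoʳ-≤ (suc r) (≮⇒≥ z≮ℓ))
            (≤-reflexive (trans (sym (+-suc r z)) (trans r+[1+z]≡L+n L+n≡q+ℓ))))) (m∸n≤m ℓ R)

  Γ : Grid m
  Γ x = w ! representative (toℕ x)

  ⟦⟧-same : ∀ {y i} → i < ℓ → y ≡ i modulo n → Γ ⟦ y ⟧ ≡ w ! i
  ⟦⟧-same {y} {i} i<ℓ y≡i with representative-spec (toℕ<n (y mod n))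
  ... | r<ℓ , inj₁ r≡z = period-mod w period r<ℓ i<ℓ (mod-trans (≡⇒mod r≡z) (mod-trans (toℕ-mod m y) y≡i))
  ... | r<ℓ , inj₂ r+[1+z]≡L+n = mirror-mod r<ℓ i<ℓ (mod-trans (mod-+ˡ _ (mod-+ˡ 1 (mod-sym (mod-trans (toℕ-mod m y) y≡i))))
                                                      (mod-trans (≡⇒mod r+[1+z]≡L+n) (+-mod L)))

  ⟦⟧-mirror : ∀ {y i} → i < ℓ → y + suc i ≡ L modulo n → Γ ⟦ y ⟧ ≡ w ! i
  ⟦⟧-mirror {y} {i} i<ℓ y+[1+i]≡L with representative-spec (toℕ<n (y mod n))
  ... | r<ℓ , inj₁ r≡z = mirror-mod r<ℓ i<ℓ (mod-trans (mod-+ʳ (suc i) (mod-trans (≡⇒mod r≡z) (toℕ-mod m y))) y+[1+i]≡L)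
  ... | r<ℓ , inj₂ r+[1+z]≡L+n = period-mod w period r<ℓ i<ℓ (mirror-cancel
          (mod-trans (≡⇒mod (m+suc[n]≡n+suc[m] _ _)) (mod-trans (≡⇒mod r+[1+z]≡L+n) (+-mod L)))
          (mod-trans (mod-+ʳ (suc i) (toℕ-mod m y)) y+[1+i]≡L))

  forward : isAppearance w m Γ zero fwd
  forward = Equivalence.from (appearance⇔ Γ w zero fwd) λ i<ℓ → ⟦⟧-same i<ℓ mod-refl

  backward : isAppearance w m Γ ((L ∸ 1) mod n) bwd
  backward = Equivalence.from (appearance⇔ Γ w ((L ∸ 1) mod n) bwd) λ {i} i<ℓ → ⟦⟧-mirror i<ℓ (begin
    P + m * i + suc i     ≡⟨ regroup P m i ⟩
    suc P + i + m * i     ≈⟨ +-+pred*-mod m (suc P) i ⟩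
    suc P                 ≈⟨ mod-+ˡ 1 (toℕ-mod m (L ∸ 1)) ⟩
    suc (L ∸ 1)           ≡⟨ suc-pred L ⟩
    L                     ∎)
    where
    open mod-Reasoning n
    P = toℕ ((L ∸ 1) mod n)
    regroup : ∀ P m i → P + m * i + suc i ≡ suc P + i + m * i
    regroup = solve-∀
    instance _ = >-nonZero 0<L

  2≤appearances : 2 ≤ appearances w m Γ
  2≤appearances = forward-backward⇒2≤appearances Γ w zero ((L ∸ 1) mod n) forward backward

/-mono-≤ : ∀ a n b d → a * suc d ≤ b * suc n → (ℤ.+ a) ℚ./ suc n ℚ.≤ (ℤ.+ b) ℚ./ suc d
/-mono-≤ a n b d ad≤bn = ℚ.toℚᵘ-cancel-≤
  (ℚᵘ.≤-respˡ-≃ (ℚᵘ.≃-sym (ℚ.toℚᵘ-fromℚᵘ (mkℚᵘ (ℤ.+ a) n)))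
    (ℚᵘ.≤-respʳ-≃ (ℚᵘ.≃-sym (ℚ.toℚᵘ-fromℚᵘ (mkℚᵘ (ℤ.+ b) d)))
      (*≤* (subst₂ ℤ._≤_ (ℤ.pos-* a (suc d)) (ℤ.pos-* b (suc n)) (ℤ.+≤+ ad≤bn)))))

c₁-≥ : ∀ w m (Γ : Grid m) k → k ≤ appearances w m Γ → (ℤ.+ k) ℚ./ suc m ℚ.≤ c₁ w m Γ
c₁-≥ w m Γ k k≤N = /-mono-≤ k m (appearances w m Γ) m (*-monoˡ-≤ (suc m) k≤N)

c₁-≤ : ∀ w m (Γ : Grid m) k {d} → 0 < d → appearances w m Γ * d ≤ k * suc m → c₁ w m Γ ℚ.≤ frac k d
c₁-≤ w m Γ k {suc d} _ Nd≤km = /-mono-≤ (appearances w m Γ) m k d Nd≤km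

Attains : Word → ℚ → Set
Attains w q = ∃[ m ] Σ (Grid m) (λ Γ → q ℚ.≤ c₁ w m Γ)

attained⇒C₁-is : ∀ w q → (∀ m (Γ : Grid m) → c₁ w m Γ ℚ.≤ q) → Attains w q → C₁-is w q
attained⇒C₁-is w q upper (m , Γ , q≤c) = upper , λ r r<q → m , Γ , ℚ.<-≤-trans r<q q≤c

attains-⊔ : ∀ w {x y} → Attains w x → Attains w y → Attains w (x ⊔ y)
attains-⊔ w {x} {y} attx atty =
  [ (λ x⊔y≡x → subst (Attains w) (sym x⊔y≡x) attx) , (λ x⊔y≡y → subst (Attains w) (sym x⊔y≡y) atty) ]′
    (ℚ.⊔-sel x y)

module _ (w : Word) where

  periodic-attains : ∀ {d} → HasPeriod w d → 0 < d → Attains w (frac 1 d)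
  periodic-attains {suc m} period _ = m , Γ , c₁-≥ w m Γ 1 1≤appearances
    where open PeriodicGrid w period

  periodic-palindrome-attains : ∀ {d} → HasPeriod w d → Palindrome w → 0 < d → Attains w (frac 2 d)
  periodic-palindrome-attains {suc m} period pal _ =
    m , Γ , c₁-≥ w m Γ 2 (2≤appearances pal)
    where open PeriodicGrid w period

  reflecting-attains : ∀ {b} → b ≡ (length w ∸ cLeft w) + (length w ∸ cRight w) → 0 < b → 0 < cLeft w →
                       Attains w (frac 2 b)
  reflecting-attains {suc m} b≡ _ 0<L =
    m , Γ , c₁-≥ w m Γ 2 2≤appearances
    where open ReflectingGrid w (proj₂ (cLeft-spec w)) (proj₂ (cRight-spec w)) 0<L
                                (proj₁ (cLeft-spec w)) (proj₁ (cRight-spec w)) b≡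

module _ (w : Word) (0<ℓ : 0 < length w) where

  private
    ℓ = length w
    a = ℓ ∸ cRepeat w
    b = (ℓ ∸ cLeft w) + (ℓ ∸ cRight w)

  0<a : 0 < a
  0<a = m<n⇒0<n∸m (proj₂ (cRepeat-spec w 0<ℓ))

  0<b : ¬ Palindrome w → 0 < b
  0<b ¬pal = ≤-trans (m<n⇒0<n∸m (cLeft<length w ¬pal)) (m≤m+n _ _)

  c₁-≤-nonPalindrome : ¬ Palindrome w → ∀ m (Γ : Grid m) → c₁ w m Γ ℚ.≤ frac 1 a ⊔ frac 2 b
  c₁-≤-nonPalindrome ¬pal m Γ = [ via-a , via-b ]′ (≤-total (2 * a) b)
    where
    N = appearances w m Γ
    bound : N * (2 * a ⊓ b) ≤ 2 * suc m
    bound = appearances-bound-nonPalindrome Γ w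
    via-a : 2 * a ≤ b → c₁ w m Γ ℚ.≤ frac 1 a ⊔ frac 2 b
    via-a 2a≤b = ℚ.≤-trans (c₁-≤ w m Γ 1 0<a Na≤n) (ℚ.p≤p⊔q (frac 1 a) (frac 2 b))
      where
      twice : ∀ N a → N * (2 * a) ≡ 2 * (N * a)
      twice = solve-∀
      Na≤n : N * a ≤ 1 * suc m
      Na≤n = subst (N * a ≤_) (sym (+-identityʳ (suc m)))
               (*-cancelˡ-≤ 2 (subst (_≤ 2 * suc m) (trans (cong (N *_) (m≤n⇒m⊓n≡m 2a≤b)) (twice N a)) bound))
    via-b : b ≤ 2 * a → c₁ w m Γ ℚ.≤ frac 1 a ⊔ frac 2 b
    via-b b≤2a = ℚ.≤-trans (c₁-≤ w m Γ 2 (0<b ¬pal) (subst (λ K → N * K ≤ 2 * suc m) (m≥n⇒m⊓n≡n b≤2a) bound))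
                           (ℚ.p≤q⊔p (frac 1 a) (frac 2 b))

  c₁-≤-palindrome : Palindrome w → ∀ m (Γ : Grid m) → c₁ w m Γ ℚ.≤ frac 2 a
  c₁-≤-palindrome pal m Γ = c₁-≤ w m Γ 2 0<a (appearances-bound-palindrome Γ w pal)

nonempty : ∀ {w : Word} {x} → x ∈ w → 0 < length w
nonempty {_ ∷ _} _ = z<s

proposition3p1 : (w : Word) → (∃[ a ] ∃[ b ] (a ∈ w × b ∈ w × a ≢ b)) →
    ((¬ Palindrome w) →
      C₁-is w (frac 1 (length w ∸ cRepeat w) ⊔ frac 2 (2 * length w ∸ (cLeft w + cRight w)))) ×
    (Palindrome w →
      (cLeft w ≡ length w) × (cRight w ≡ length w) × C₁-is w (frac 2 (length w ∸ cRepeat w)))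
proposition3p1 w (x , _ , x∈w , _) = nonPalindromic , palindromic
  where
  0<ℓ = nonempty x∈w
  a = length w ∸ cRepeat w
  b≡ : 2 * length w ∸ (cLeft w + cRight w) ≡ (length w ∸ cLeft w) + (length w ∸ cRight w)
  b≡ = 2*m∸[n+o]≡[m∸n]+[m∸o] (proj₂ (cLeft-spec w)) (proj₂ (cRight-spec w))
  nonPalindromic : ¬ Palindrome w → C₁-is w (frac 1 a ⊔ frac 2 (2 * length w ∸ (cLeft w + cRight w)))
  nonPalindromic ¬pal = subst (λ b → C₁-is w (frac 1 a ⊔ frac 2 b)) (sym b≡)
    (attained⇒C₁-is w _ (c₁-≤-nonPalindrome w 0<ℓ ¬pal)
      (attains-⊔ w (periodic-attains w (cRepeat-period w 0<ℓ) (0<a w 0<ℓ))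
                 (reflecting-attains w refl (0<b w 0<ℓ ¬pal) (cLeft-positive w 0<ℓ))))
  palindromic : Palindrome w → (cLeft w ≡ length w) × (cRight w ≡ length w) × C₁-is w (frac 2 a)
  palindromic pal = cLeft-palindrome w pal , cRight-palindrome w pal ,
    attained⇒C₁-is w _ (c₁-≤-palindrome w 0<ℓ pal) (periodic-palindrome-attains w (cRepeat-period w 0<ℓ) pal (0<a w 0<ℓ))
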